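{- For every integer $k\geq1$ and every integer $w$ sufficiently large relative to $k$, if $p\geq p_{w,k}$ is an integer then $|V(G^{k}_{w,p})|\leq5\cdot2^{p}$.
   Context: For integers $w,p\geq0$ and $k\geq1$ define $\alpha(w,p)=\frac{1}{1+(2/3)^{w}}\Big(\frac{2+(2/3)^{w}}{1+(2/3)^{w}}\Big)^{p-1}$, $\beta_k(w)=(2k+4)(\frac{3}{2})^{w}$ and $\delta_k(w)=(2+(\frac{2}{3})^{w})\beta_k(w)$. Let $p_{w,k}$ be the smallest integer such that $\alpha(w,p_{w,k}+1)\geq\beta_k(w)$. For $p\geq p_{w,k}$ define $G^{k}_{w,p}$ recursively: $G^{k}_{w,p_{w,k}}$ is the complete graph $K_{\lceil\delta_k(w)\rceil}$, and for $p\geq p_{w,k}+1$, $G^{k}_{w,p}$ is obtained from a complete graph $K_{(k+1)(w+1)}$ and two disjoint copies of $G^{k}_{w,p-1}$ by adding all edges between the vertices of $K_{(k+1)(w+1)}$ and the vertices of the two copies. -}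

module Defs where

open import Data.Nat as ℕ using (ℕ; zero; suc)
open import Data.Integer as ℤ using (ℤ)
open import Data.Rational as ℚ using (ℚ; 0ℚ; 1ℚ; _+_; _*_; _÷_; _≤_; NonZero; Positive; NonNegative)
open import Data.Rational.Properties using (nonNeg*nonNeg⇒nonNeg; pos+nonNeg⇒pos; pos⇒nonZero; pos*pos⇒pos; 1/pos⇒pos)
open import Data.Fin using (Fin; splitAt)
open import Data.Fin.Properties using (_≟_)
open import Data.Sum using (inj₁; inj₂)
open import Data.Bool using (Bool; true; false; not)
open import Relation.Nullary.Decidable using (⌊_⌋)
open import Relation.Nullary using (¬_)

pow : ℚ → ℕ → ℚ
pow x zero    = 1ℚ
pow x (suc n) = x * pow x n

twoThirds : ℚ
twoThirds = ℤ.+ 2 ℚ./ 3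

r : ℕ → ℚ
r w = pow twoThirds w

r-nonNeg : ∀ w → NonNegative (r w)
r-nonNeg zero    = _
r-nonNeg (suc w) = nonNeg*nonNeg⇒nonNeg twoThirds (pow twoThirds w) {{r-nonNeg w}}

fromℕ : ℕ → ℚ
fromℕ n = ℤ.+ n ℚ./ 1

onePlusR : ℕ → ℚ
onePlusR w = 1ℚ + r w

twoPlusR : ℕ → ℚ
twoPlusR w = fromℕ 2 + r w

onePlusR-pos : ∀ w → Positive (onePlusR w)
onePlusR-pos w = pos+nonNeg⇒pos 1ℚ (r w) {{r-nonNeg w}}

twoPlusR-pos : ∀ w → Positive (twoPlusR w)
twoPlusR-pos w = pos+nonNeg⇒pos (fromℕ 2) (r w) {{r-nonNeg w}}

q : ℕ → ℚ
q w = _÷_ (twoPlusR w) (onePlusR w) {{pos⇒nonZero (onePlusR w) {{onePlusR-pos w}}}}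

c : ℕ → ℚ
c w = _÷_ 1ℚ (onePlusR w) {{pos⇒nonZero (onePlusR w) {{onePlusR-pos w}}}}

q-pos : ∀ w → Positive (q w)
q-pos w = pos*pos⇒pos (twoPlusR w) {{twoPlusR-pos w}} _ {{1/pos⇒pos (onePlusR w) {{onePlusR-pos w}}}}

-- α(w,p) = 1/(1+(2/3)^w) · ((2+(2/3)^w)/(1+(2/3)^w))^(p-1)
-- (for p = 0 the exponent is -1, i.e. we divide by the base)
α : ℕ → ℕ → ℚ
α w zero    = _÷_ (c w) (q w) {{pos⇒nonZero (q w) {{q-pos w}}}}
α w (suc p) = c w * pow (q w) p

β : ℕ → ℕ → ℚ
β k w = fromℕ (2 ℕ.* k ℕ.+ 4) * pow (ℤ.+ 3 ℚ./ 2) w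

δ : ℕ → ℕ → ℚ
δ k w = twoPlusR w * β k w

-- ⌈δ_k(w)⌉ as a natural number (δ_k(w) > 0)
ceilδ : ℕ → ℕ → ℕ
ceilδ k w = ℤ.∣ ℚ.ceiling (δ k w) ∣

IsPwk : ℕ → ℕ → ℕ → Set
IsPwk w k p = (β k w ≤ α w (suc p)) × (∀ p' → p' ℕ.< p → ¬ (β k w ≤ α w (suc p')))
  where open import Data.Product using (_×_)

record Graph : Set where
  field
    n   : ℕ
    adj : Fin n → Fin n → Bool

open Graph public

∣V∣ : Graph → ℕ
∣V∣ G = n G

K : ℕ → Graph
K m = record { n = m ; adj = λ i j → not ⌊ i ≟ j ⌋ }

-- join of K_m with two disjoint copies of G:
-- vertices Fin (m + (|V(G)| + |V(G)|)); the first m form the clique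
joinK2 : ℕ → Graph → Graph
joinK2 m G = record { n = m ℕ.+ (N ℕ.+ N) ; adj = A }
  where
  N = n G
  A : Fin (m ℕ.+ (N ℕ.+ N)) → Fin (m ℕ.+ (N ℕ.+ N)) → Bool
  A i j with splitAt m i | splitAt m j
  ... | inj₁ a | inj₁ b = not ⌊ a ≟ b ⌋
  ... | inj₁ _ | inj₂ _ = true
  ... | inj₂ _ | inj₁ _ = true
  ... | inj₂ x | inj₂ y with splitAt N x | splitAt N y
  ...   | inj₁ u | inj₁ v = adj G u v
  ...   | inj₂ u | inj₂ v = adj G u v
  ...   | inj₁ _ | inj₂ _ = false
  ...   | inj₂ _ | inj₁ _ = false

-- G k w p₀ d  =  G^k_{w, p₀ + d}, where p₀ is meant to be p_{w,k}
Gkw : (k w p₀ d : ℕ) → Graph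
Gkw k w p₀ zero    = K (ceilδ k w)
Gkw k w p₀ (suc d) = joinK2 (suc k ℕ.* suc w) (Gkw k w p₀ d)

-- Write N_d = |V(G^k_{w, p_{w,k}+d})| and m = (k+1)(w+1). The recursion gives N_{d+1} + m = 2 (N_d + m),
-- so N_d + m = 2^d (⌈δ_k(w)⌉ + m), and it suffices to bound ⌈δ_k(w)⌉ + m ≤ 5·2^{p_{w,k}}.
-- Since 2 + (2/3)^w ≤ 3 we have ⌈δ_k(w)⌉ ≤ 3 β_k(w) + 1, and Bernoulli's inequality (3/2)^w ≥ 1 + w/2 gives
-- m + 1 ≤ 2 β_k(w). Finally β_k(w) ≤ α(w, p_{w,k}+1) ≤ 2^{p_{w,k}}, because both factors of α are bounded
-- by those for (2/3)^w = 0. No largeness of w is needed.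
module Submission where

open import Defs

module RationalEstimates where

  open import Data.Nat as ℕ using (zero; suc)
  import Data.Nat.Properties as ℕ
  import Data.Nat.Tactic.RingSolver as ℕ-Solver
  open import Data.Nat.Coprimality as Coprimality using (Coprime; 1-coprimeTo)
  open import Data.Integer as ℤ using (+_; ∣_∣)
  import Data.Integer.Properties as ℤ
  import Data.Integer.DivMod as ℤ
  import Data.Integer.Tactic.RingSolver as ℤ-Solver
  open import Data.Rational using (ℚ; mkℚ; 0ℚ; 1ℚ; _+_; _*_; _/_; _÷_; 1/_; _≤_; *≤*; ceiling;
                                   toℚᵘ; Positive; NonNegative)
  open import Data.Rational.Properties
  open import Data.Rational.Unnormalised as ℚᵘ using (mkℚᵘ; *≡*)
  import Data.Rational.Unnormalised.Properties as ℚᵘ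
  open import Relation.Binary.PropositionalEquality
  open import Relation.Nullary.Decidable using (toWitness)

  toℚᵘ-fromℕ : ∀ n → toℚᵘ (fromℕ n) ≡ mkℚᵘ (+ n) 0
  toℚᵘ-fromℕ n = cong toℚᵘ (normalize-coprime (Coprimality.sym (1-coprimeTo n)))

  fromℕ-+ : ∀ a b → fromℕ (a ℕ.+ b) ≡ fromℕ a + fromℕ b
  fromℕ-+ a b = toℚᵘ-injective (begin
      toℚᵘ (fromℕ (a ℕ.+ b))            ≡⟨ toℚᵘ-fromℕ (a ℕ.+ b) ⟩
      mkℚᵘ (+ (a ℕ.+ b)) 0              ≡⟨ cong (λ i → mkℚᵘ i 0) (ℤ.pos-+ a b) ⟩
      mkℚᵘ (+ a ℤ.+ + b) 0              ≈⟨ *≡* (sum-equation (+ a) (+ b)) ⟩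
      mkℚᵘ (+ a) 0 ℚᵘ.+ mkℚᵘ (+ b) 0     ≡⟨ sym (cong₂ ℚᵘ._+_ (toℚᵘ-fromℕ a) (toℚᵘ-fromℕ b)) ⟩
      toℚᵘ (fromℕ a) ℚᵘ.+ toℚᵘ (fromℕ b) ≈⟨ ℚᵘ.≃-sym (toℚᵘ-homo-+ (fromℕ a) (fromℕ b)) ⟩
      toℚᵘ (fromℕ a + fromℕ b)          ∎)
    where
    open ℚᵘ.≃-Reasoning
    sum-equation : ∀ x y → (x ℤ.+ y) ℤ.* + 1 ≡ (x ℤ.* + 1 ℤ.+ y ℤ.* + 1) ℤ.* + 1
    sum-equation = ℤ-Solver.solve-∀

  fromℕ-* : ∀ a b → fromℕ (a ℕ.* b) ≡ fromℕ a * fromℕ b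
  fromℕ-* a b = toℚᵘ-injective (begin
      toℚᵘ (fromℕ (a ℕ.* b))            ≡⟨ toℚᵘ-fromℕ (a ℕ.* b) ⟩
      mkℚᵘ (+ (a ℕ.* b)) 0              ≡⟨ cong (λ i → mkℚᵘ i 0) (ℤ.pos-* a b) ⟩
      mkℚᵘ (+ a) 0 ℚᵘ.* mkℚᵘ (+ b) 0     ≡⟨ sym (cong₂ ℚᵘ._*_ (toℚᵘ-fromℕ a) (toℚᵘ-fromℕ b)) ⟩
      toℚᵘ (fromℕ a) ℚᵘ.* toℚᵘ (fromℕ b) ≈⟨ ℚᵘ.≃-sym (toℚᵘ-homo-* (fromℕ a) (fromℕ b)) ⟩
      toℚᵘ (fromℕ a * fromℕ b)          ∎)
    where open ℚᵘ.≃-Reasoning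

  fromℕ-mono-≤ : ∀ {a b} → a ℕ.≤ b → fromℕ a ≤ fromℕ b
  fromℕ-mono-≤ {a} {b} a≤b = toℚᵘ-cancel-≤ (subst₂ ℚᵘ._≤_ (sym (toℚᵘ-fromℕ a)) (sym (toℚᵘ-fromℕ b))
    (ℚᵘ.*≤* (subst₂ ℤ._≤_ (sym (ℤ.*-identityʳ (+ a))) (sym (ℤ.*-identityʳ (+ b))) (ℤ.+≤+ a≤b))))

  fromℕ-cancel-≤ : ∀ {a b} → fromℕ a ≤ fromℕ b → a ℕ.≤ b
  fromℕ-cancel-≤ {a} {b} fa≤fb
    with ℚᵘ.*≤* ua≤ub ← subst₂ ℚᵘ._≤_ (toℚᵘ-fromℕ a) (toℚᵘ-fromℕ b) (toℚᵘ-mono-≤ fa≤fb)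
    with ℤ.+≤+ a≤b ← subst₂ ℤ._≤_ (ℤ.*-identityʳ (+ a)) (ℤ.*-identityʳ (+ b)) ua≤ub
    = a≤b

  fromℕ-nonNeg : ∀ n → NonNegative (fromℕ n)
  fromℕ-nonNeg n = normalize-nonNeg n 1

  mkℚ-*-denominator : ∀ n d .(c : Coprime n (suc d)) → mkℚ (+ n) d c * fromℕ (suc d) ≡ fromℕ n
  mkℚ-*-denominator n d c = toℚᵘ-injective (begin
      toℚᵘ (mkℚ (+ n) d c * fromℕ (suc d))          ≈⟨ toℚᵘ-homo-* (mkℚ (+ n) d c) (fromℕ (suc d)) ⟩
      mkℚᵘ (+ n) d ℚᵘ.* toℚᵘ (fromℕ (suc d))        ≡⟨ cong (mkℚᵘ (+ n) d ℚᵘ.*_) (toℚᵘ-fromℕ (suc d)) ⟩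
      mkℚᵘ (+ n) d ℚᵘ.* mkℚᵘ (+ suc d) 0            ≈⟨ *≡* denominators-cancel ⟩
      mkℚᵘ (+ n) 0                                  ≡⟨ sym (toℚᵘ-fromℕ n) ⟩
      toℚᵘ (fromℕ n)                                ∎)
    where
    open ℚᵘ.≃-Reasoning
    denominators-cancel : (+ n ℤ.* + suc d) ℤ.* + 1 ≡ + n ℤ.* + (suc d ℕ.* 1)
    denominators-cancel = trans (ℤ.*-identityʳ _) (cong (λ m → + n ℤ.* + m) (sym (ℕ.*-identityʳ (suc d))))

  -- ⌈_⌉ is defined as -⌊-_⌋; splitting on n only lets ℤ.- (+ n) compute.
  ⌈n/d⌉≡-[-n/d] : ∀ n d .(c : Coprime n (suc d)) → ⌈ mkℚ (+ n) d c ⌉ ≡ ℤ.- ((ℤ.- + n) ℤ./ + suc d)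
  ⌈n/d⌉≡-[-n/d] zero    d c = refl
  ⌈n/d⌉≡-[-n/d] (suc n) d c = refl

  -[a/d]*d≡-a+a%d : ∀ a d → ℤ.- (a ℤ./ + suc d) ℤ.* + suc d ≡ ℤ.- a ℤ.+ + (a ℤ.% + suc d)
  -[a/d]*d≡-a+a%d a d = begin
      ℤ.- quot ℤ.* + D                       ≡⟨ ℤ.neg-distribˡ-* quot (+ D) ⟨
      ℤ.- (quot ℤ.* + D)                     ≡⟨ negate-split (+ rem) (quot ℤ.* + D) ⟩
      ℤ.- (+ rem ℤ.+ quot ℤ.* + D) ℤ.+ + rem ≡⟨ cong (λ i → ℤ.- i ℤ.+ + rem) (ℤ.a≡a%n+[a/n]*n a (+ D)) ⟨
      ℤ.- a ℤ.+ + rem                        ∎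
    where
    open ≡-Reasoning
    D = suc d
    quot = a ℤ./ + D
    rem = a ℤ.% + D
    negate-split : ∀ r q → ℤ.- q ≡ ℤ.- (r ℤ.+ q) ℤ.+ r
    negate-split = ℤ-Solver.solve-∀

  ∣⌈n/d⌉∣*d≤n+d : ∀ n d .(c : Coprime n (suc d)) → ∣ ⌈ mkℚ (+ n) d c ⌉ ∣ ℕ.* suc d ℕ.≤ n ℕ.+ suc d
  ∣⌈n/d⌉∣*d≤n+d n d c = begin
      ∣ ⌈ mkℚ (+ n) d c ⌉ ∣ ℕ.* D    ≡⟨ cong (λ i → ∣ i ∣ ℕ.* D) (⌈n/d⌉≡-[-n/d] n d c) ⟩
      ∣ ℤ.- (-n ℤ./ + D) ∣ ℕ.* D     ≡⟨ ℤ.abs-* (ℤ.- (-n ℤ./ + D)) (+ D) ⟨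
      ∣ ℤ.- (-n ℤ./ + D) ℤ.* + D ∣   ≡⟨ cong ∣_∣ (-[a/d]*d≡-a+a%d -n d) ⟩
      ∣ ℤ.- -n ℤ.+ + rem ∣           ≡⟨ cong (λ i → ∣ i ℤ.+ + rem ∣) (ℤ.neg-involutive (+ n)) ⟩
      ∣ + n ℤ.+ + rem ∣              ≡⟨ cong ∣_∣ (ℤ.pos-+ n rem) ⟨
      n ℕ.+ rem                      ≤⟨ ℕ.+-monoʳ-≤ n (ℕ.<⇒≤ (ℤ.n%d<d -n (+ D))) ⟩
      n ℕ.+ D                        ∎
    where
    open ℕ.≤-Reasoning
    D = suc d
    -n = ℤ.- + n
    rem = -n ℤ.% + D

  ∣⌈x⌉∣≤x+1 : ∀ x → 0ℚ ≤ x → fromℕ ∣ ⌈ x ⌉ ∣ ≤ x + 1ℚ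
  ∣⌈x⌉∣≤x+1 x@(mkℚ (+ n) d c) _ = *-cancelʳ-≤-pos (fromℕ D) {{normalize-pos D 1}} (begin
      fromℕ ∣ ⌈ x ⌉ ∣ * fromℕ D      ≡⟨ fromℕ-* ∣ ⌈ x ⌉ ∣ D ⟨
      fromℕ (∣ ⌈ x ⌉ ∣ ℕ.* D)        ≤⟨ fromℕ-mono-≤ (∣⌈n/d⌉∣*d≤n+d n d c) ⟩
      fromℕ (n ℕ.+ D)                ≡⟨ fromℕ-+ n D ⟩
      fromℕ n + fromℕ D              ≡⟨ cong₂ _+_ (mkℚ-*-denominator n d c) (*-identityˡ (fromℕ D)) ⟨
      x * fromℕ D + 1ℚ * fromℕ D     ≡⟨ *-distribʳ-+ (fromℕ D) x 1ℚ ⟨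
      (x + 1ℚ) * fromℕ D             ∎)
    where
    open ≤-Reasoning
    D = suc d
  ∣⌈x⌉∣≤x+1 (mkℚ ℤ.-[1+ n ] d c) (*≤* ())

  pow-nonNeg : ∀ x .{{_ : NonNegative x}} n → NonNegative (pow x n)
  pow-nonNeg x zero    = _
  pow-nonNeg x (suc n) = nonNeg*nonNeg⇒nonNeg x (pow x n) {{pow-nonNeg x n}}

  pow-mono-≤ : ∀ {x y} .{{_ : NonNegative x}} .{{_ : NonNegative y}} → x ≤ y → ∀ n → pow x n ≤ pow y n
  pow-mono-≤         x≤y zero    = ≤-refl
  pow-mono-≤ {x} {y} x≤y (suc n) = ≤-trans (*-monoʳ-≤-nonNeg (pow x n) {{pow-nonNeg x n}} x≤y)
                                           (*-monoˡ-≤-nonNeg y (pow-mono-≤ x≤y n))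

  pow-fromℕ : ∀ a n → pow (fromℕ a) n ≡ fromℕ (a ℕ.^ n)
  pow-fromℕ a zero    = refl
  pow-fromℕ a (suc n) = trans (cong (fromℕ a *_) (pow-fromℕ a n)) (sym (fromℕ-* a (a ℕ.^ n)))

  x≤z*y⇒x÷y≤z : ∀ x y z .{{_ : Positive y}} → x ≤ z * y → _÷_ x y {{pos⇒nonZero y}} ≤ z
  x≤z*y⇒x÷y≤z x y z x≤zy = begin
      x * 1/ y          ≤⟨ *-monoʳ-≤-nonNeg (1/ y) {{pos⇒nonNeg (1/ y) {{1/pos⇒pos y}}}} x≤zy ⟩
      z * y * 1/ y      ≡⟨ *-assoc z y (1/ y) ⟩
      z * (y * 1/ y)    ≡⟨ cong (z *_) (*-inverseʳ y) ⟩
      z * 1ℚ            ≡⟨ *-identityʳ z ⟩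
      z                 ∎
    where
    instance _ = pos⇒nonZero y
    open ≤-Reasoning

  r≤1 : ∀ w → r w ≤ 1ℚ
  r≤1 w = begin
    pow twoThirds w     ≤⟨ pow-mono-≤ (toWitness {a? = twoThirds ≤? 1ℚ} _) w ⟩
    pow (fromℕ 1) w     ≡⟨ pow-fromℕ 1 w ⟩
    fromℕ (1 ℕ.^ w)     ≡⟨ cong fromℕ (ℕ.^-zeroˡ w) ⟩
    1ℚ                  ∎
    where open ≤-Reasoning

  r≥0 : ∀ w → 0ℚ ≤ r w
  r≥0 w = nonNegative⁻¹ (r w) {{r-nonNeg w}}

  c≤1 : ∀ w → c w ≤ 1ℚ
  c≤1 w = x≤z*y⇒x÷y≤z 1ℚ (onePlusR w) 1ℚ {{onePlusR-pos w}} (begin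
    1ℚ               ≤⟨ +-monoʳ-≤ 1ℚ (r≥0 w) ⟩
    1ℚ + r w         ≡⟨ *-identityˡ (1ℚ + r w) ⟨
    1ℚ * onePlusR w  ∎)
    where open ≤-Reasoning

  q≤2 : ∀ w → q w ≤ fromℕ 2
  q≤2 w = x≤z*y⇒x÷y≤z (twoPlusR w) (onePlusR w) (fromℕ 2) {{onePlusR-pos w}} (begin
    fromℕ 2 + r w               ≤⟨ +-monoʳ-≤ (fromℕ 2) r≤r+r ⟩
    fromℕ 2 + (r w + r w)       ≡⟨ cong (_+_ (fromℕ 2)) (sym (twice (r w))) ⟩
    fromℕ 2 + fromℕ 2 * r w     ≡⟨ cong (_+ fromℕ 2 * r w) (*-identityʳ (fromℕ 2)) ⟨
    fromℕ 2 * 1ℚ + fromℕ 2 * r w ≡⟨ *-distribˡ-+ (fromℕ 2) 1ℚ (r w) ⟨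
    fromℕ 2 * onePlusR w        ∎)
    where
    open ≤-Reasoning
    r≤r+r : r w ≤ r w + r w
    r≤r+r = ≤-trans (≤-reflexive (sym (+-identityˡ (r w)))) (+-monoˡ-≤ (r w) (r≥0 w))
    twice : ∀ x → fromℕ 2 * x ≡ x + x
    twice x = trans (*-distribʳ-+ x 1ℚ 1ℚ) (cong₂ _+_ (*-identityˡ x) (*-identityˡ x))

  α-suc≤2^ : ∀ w p → α w (suc p) ≤ fromℕ (2 ℕ.^ p)
  α-suc≤2^ w p = begin
      c w * pow (q w) p   ≤⟨ *-monoʳ-≤-nonNeg (pow (q w) p) {{pow-nonNeg (q w) p}} (c≤1 w) ⟩
      1ℚ * pow (q w) p    ≡⟨ *-identityˡ (pow (q w) p) ⟩
      pow (q w) p         ≤⟨ pow-mono-≤ (q≤2 w) p ⟩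
      pow (fromℕ 2) p     ≡⟨ pow-fromℕ 2 p ⟩
      fromℕ (2 ℕ.^ p)     ∎
    where
    open ≤-Reasoning
    instance _ = pos⇒nonNeg (q w) {{q-pos w}}

  threeHalves : ℚ
  threeHalves = + 3 / 2

  w+2≤2*[3/2]^w : ∀ w → fromℕ (w ℕ.+ 2) ≤ fromℕ 2 * pow threeHalves w
  w+2≤2*[3/2]^w zero    = ≤-refl
  w+2≤2*[3/2]^w (suc w) = begin
      fromℕ (suc w ℕ.+ 2)                          ≤⟨ step ⟩
      threeHalves * fromℕ (w ℕ.+ 2)                ≤⟨ *-monoˡ-≤-nonNeg threeHalves (w+2≤2*[3/2]^w w) ⟩
      threeHalves * (fromℕ 2 * pow threeHalves w)  ≡⟨ *-assoc threeHalves (fromℕ 2) (pow threeHalves w) ⟨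
      threeHalves * fromℕ 2 * pow threeHalves w    ≡⟨ cong (_* pow threeHalves w) (*-comm threeHalves (fromℕ 2)) ⟩
      fromℕ 2 * threeHalves * pow threeHalves w    ≡⟨ *-assoc (fromℕ 2) threeHalves (pow threeHalves w) ⟩
      fromℕ 2 * pow threeHalves (suc w)            ∎
    where
    open ≤-Reasoning
    2[w+3]≤3[w+2] : 2 ℕ.* (suc w ℕ.+ 2) ℕ.≤ 3 ℕ.* (w ℕ.+ 2)
    2[w+3]≤3[w+2] = subst (2 ℕ.* (suc w ℕ.+ 2) ℕ.≤_) (expand w) (ℕ.m≤m+n _ w)
      where
      expand : ∀ w → 2 ℕ.* (suc w ℕ.+ 2) ℕ.+ w ≡ 3 ℕ.* (w ℕ.+ 2)
      expand = ℕ-Solver.solve-∀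
    step : fromℕ (suc w ℕ.+ 2) ≤ threeHalves * fromℕ (w ℕ.+ 2)
    step = *-cancelˡ-≤-pos (fromℕ 2) {{normalize-pos 2 1}} (begin
      fromℕ 2 * fromℕ (suc w ℕ.+ 2)                ≡⟨ fromℕ-* 2 (suc w ℕ.+ 2) ⟨
      fromℕ (2 ℕ.* (suc w ℕ.+ 2))                  ≤⟨ fromℕ-mono-≤ 2[w+3]≤3[w+2] ⟩
      fromℕ (3 ℕ.* (w ℕ.+ 2))                      ≡⟨ fromℕ-* 3 (w ℕ.+ 2) ⟩
      fromℕ 2 * threeHalves * fromℕ (w ℕ.+ 2)      ≡⟨ *-assoc (fromℕ 2) threeHalves (fromℕ (w ℕ.+ 2)) ⟩
      fromℕ 2 * (threeHalves * fromℕ (w ℕ.+ 2))    ∎)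

  β-nonNeg : ∀ k w → NonNegative (β k w)
  β-nonNeg k w = nonNeg*nonNeg⇒nonNeg (fromℕ (2 ℕ.* k ℕ.+ 4)) {{fromℕ-nonNeg (2 ℕ.* k ℕ.+ 4)}}
                                      (pow threeHalves w) {{pow-nonNeg threeHalves w}}

  [k+1][w+1]+1≤2β : ∀ k w → fromℕ (suc k ℕ.* suc w) + 1ℚ ≤ fromℕ 2 * β k w
  [k+1][w+1]+1≤2β k w = begin
      fromℕ (suc k ℕ.* suc w) + 1ℚ             ≡⟨ fromℕ-+ (suc k ℕ.* suc w) 1 ⟨
      fromℕ (suc k ℕ.* suc w ℕ.+ 1)           ≤⟨ fromℕ-mono-≤ [k+1][w+1]+1≤[2k+4][w+2] ⟩
      fromℕ ((2 ℕ.* k ℕ.+ 4) ℕ.* (w ℕ.+ 2))   ≡⟨ fromℕ-* (2 ℕ.* k ℕ.+ 4) (w ℕ.+ 2) ⟩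
      A * fromℕ (w ℕ.+ 2)                     ≤⟨ *-monoˡ-≤-nonNeg A {{fromℕ-nonNeg (2 ℕ.* k ℕ.+ 4)}} (w+2≤2*[3/2]^w w) ⟩
      A * (fromℕ 2 * P)                       ≡⟨ *-assoc A (fromℕ 2) P ⟨
      A * fromℕ 2 * P                         ≡⟨ cong (_* P) (*-comm A (fromℕ 2)) ⟩
      fromℕ 2 * A * P                         ≡⟨ *-assoc (fromℕ 2) A P ⟩
      fromℕ 2 * β k w                         ∎
    where
    open ≤-Reasoning
    A = fromℕ (2 ℕ.* k ℕ.+ 4)
    P = pow threeHalves w
    [k+1][w+1]+1≤[2k+4][w+2] : suc k ℕ.* suc w ℕ.+ 1 ℕ.≤ (2 ℕ.* k ℕ.+ 4) ℕ.* (w ℕ.+ 2)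
    [k+1][w+1]+1≤[2k+4][w+2] = subst (suc k ℕ.* suc w ℕ.+ 1 ℕ.≤_) (expand k w) (ℕ.m≤m+n _ _)
      where
      expand : ∀ k w → suc k ℕ.* suc w ℕ.+ 1 ℕ.+ (k ℕ.* w ℕ.+ 3 ℕ.* k ℕ.+ 3 ℕ.* w ℕ.+ 6)
                       ≡ (2 ℕ.* k ℕ.+ 4) ℕ.* (w ℕ.+ 2)
      expand = ℕ-Solver.solve-∀

  δ≤3β : ∀ k w → δ k w ≤ fromℕ 3 * β k w
  δ≤3β k w = *-monoʳ-≤-nonNeg (β k w) {{β-nonNeg k w}} (+-monoʳ-≤ (fromℕ 2) (r≤1 w))

  ⌈δ⌉+[k+1][w+1]≤5*2^ : ∀ k w p → β k w ≤ α w (suc p) → ceilδ k w ℕ.+ suc k ℕ.* suc w ℕ.≤ 5 ℕ.* 2 ℕ.^ p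
  ⌈δ⌉+[k+1][w+1]≤5*2^ k w p β≤α = fromℕ-cancel-≤ (begin
      fromℕ (ceilδ k w ℕ.+ m)         ≡⟨ fromℕ-+ (ceilδ k w) m ⟩
      fromℕ (ceilδ k w) + fromℕ m     ≤⟨ +-monoˡ-≤ (fromℕ m) (∣⌈x⌉∣≤x+1 (δ k w) δ≥0) ⟩
      δ k w + 1ℚ + fromℕ m            ≡⟨ +-assoc (δ k w) 1ℚ (fromℕ m) ⟩
      δ k w + (1ℚ + fromℕ m)          ≡⟨ cong (_+_ (δ k w)) (+-comm 1ℚ (fromℕ m)) ⟩
      δ k w + (fromℕ m + 1ℚ)          ≤⟨ +-mono-≤ (δ≤3β k w) ([k+1][w+1]+1≤2β k w) ⟩
      fromℕ 3 * B + fromℕ 2 * B       ≡⟨ *-distribʳ-+ B (fromℕ 3) (fromℕ 2) ⟨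
      fromℕ 5 * B                     ≤⟨ *-monoˡ-≤-nonNeg (fromℕ 5) {{fromℕ-nonNeg 5}} (≤-trans β≤α (α-suc≤2^ w p)) ⟩
      fromℕ 5 * fromℕ (2 ℕ.^ p)       ≡⟨ fromℕ-* 5 (2 ℕ.^ p) ⟨
      fromℕ (5 ℕ.* 2 ℕ.^ p)           ∎)
    where
    open ≤-Reasoning
    m = suc k ℕ.* suc w
    B = β k w
    δ≥0 : 0ℚ ≤ δ k w
    δ≥0 = nonNegative⁻¹ (δ k w)
      {{nonNeg*nonNeg⇒nonNeg (twoPlusR w) {{pos⇒nonNeg (twoPlusR w) {{twoPlusR-pos w}}}} B {{β-nonNeg k w}}}}

open RationalEstimates using (⌈δ⌉+[k+1][w+1]≤5*2^)

open import Data.Nat using (ℕ; zero; suc; _+_; _≤_; _∸_; _*_; _^_)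
open import Data.Nat.Properties using (+-identityʳ; m≤m+n; *-monoʳ-≤; *-assoc; m+[n∸m]≡n; ^-distribˡ-+-*; module ≤-Reasoning)
import Data.Nat.Tactic.RingSolver as ℕ-Solver
open import Data.Product using (∃; _,_)
open import Relation.Binary.PropositionalEquality using (_≡_; cong; sym; module ≡-Reasoning)

∣V∣-Gkw+clique : ∀ k w p₀ d → ∣V∣ (Gkw k w p₀ d) + suc k * suc w ≡ 2 ^ d * (ceilδ k w + suc k * suc w)
∣V∣-Gkw+clique k w p₀ zero    = sym (+-identityʳ _)
∣V∣-Gkw+clique k w p₀ (suc d) = begin
    m + (N + N) + m     ≡⟨ double m N ⟩
    2 * (N + m)         ≡⟨ cong (2 *_) (∣V∣-Gkw+clique k w p₀ d) ⟩
    2 * (2 ^ d * X)     ≡⟨ *-assoc 2 (2 ^ d) X ⟨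
    2 ^ suc d * X       ∎
  where
  open ≡-Reasoning
  m = suc k * suc w
  N = ∣V∣ (Gkw k w p₀ d)
  X = ceilδ k w + m
  double : ∀ m N → m + (N + N) + m ≡ 2 * (N + m)
  double = ℕ-Solver.solve-∀

lemma4p11 : (k : ℕ) → 1 ≤ k →
    ∃ λ W → (w : ℕ) → W ≤ w →
    (p₀ : ℕ) → IsPwk w k p₀ →
    (p : ℕ) → p₀ ≤ p →
    ∣V∣ (Gkw k w p₀ (p ∸ p₀)) ≤ 5 * 2 ^ p
lemma4p11 k _ = 0 , λ w _ p₀ (β≤α , _) p p₀≤p → let d = p ∸ p₀ in begin
    ∣V∣ (Gkw k w p₀ d)                       ≤⟨ m≤m+n _ _ ⟩
    ∣V∣ (Gkw k w p₀ d) + suc k * suc w       ≡⟨ ∣V∣-Gkw+clique k w p₀ d ⟩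
    2 ^ d * (ceilδ k w + suc k * suc w)      ≤⟨ *-monoʳ-≤ (2 ^ d) (⌈δ⌉+[k+1][w+1]≤5*2^ k w p₀ β≤α) ⟩
    2 ^ d * (5 * 2 ^ p₀)                     ≡⟨ rearrange (2 ^ p₀) (2 ^ d) ⟩
    5 * (2 ^ p₀ * 2 ^ d)                     ≡⟨ cong (5 *_) (^-distribˡ-+-* 2 p₀ d) ⟨
    5 * 2 ^ (p₀ + d)                         ≡⟨ cong (λ e → 5 * 2 ^ e) (m+[n∸m]≡n p₀≤p) ⟩
    5 * 2 ^ p                                ∎
  where
  open ≤-Reasoning
  rearrange : ∀ a b → b * (5 * a) ≡ 5 * (a * b)
  rearrange = ℕ-Solver.solve-∀
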